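{- Let $\mathbb{B}\in\mathcal{V}(\mathbb{A}'(\mathcal{T}))$. If $\mathbb{B}$ satisfies the identity $S_2(u,v,x,y,z)\approx 0$, then $\mathbb{B}$ satisfies the identities $J(x,y,z)\approx x\wedge y$ and $J'(x,y,z)\approx K(x,y,z)\approx x\wedge y\wedge z$.
   Context: $\mathcal{T}$ is a Turing machine with states $\mu_0,\dots,\mu_n$ and $\mathbb{A}'(\mathcal{T})$ is the following algebra; $\mathcal{V}(\mathbb{A}'(\mathcal{T}))$ is the variety it generates, whose members interpret the same operation symbols. Let $U=\{1,2,H\}$, $W=\{C,D,\partial C,\partial D\}$, $A=\{0\}\cup U\cup W$; for $0\le i\le n$ and $r,s\in\{0,1\}$ let $V_{ir}^s=\{C_{ir}^s,D_{ir}^s,M_i^r,\partial C_{ir}^s,\partial D_{ir}^s,\partial M_i^r\}$, $V_{ir}=V_{ir}^0\cup V_{ir}^1$, $V_i=V_{i0}\cup V_{i1}$, $V=\bigcup_i V_i$ (all symbols distinct). The universe is $A\cup V$. $\partial$ denotes the involution of $V\cup W$ exchanging $x$ and $\partial x$; it is not an operation. Fundamental operations: - constant $0$ and $\wedge$ making a flat meet semilattice with bottom $0$; for $p,q$ each equal to $x$ or $0$, $p\vee q$ is their join. - multiplication: $2\cdot D=H\cdot C=D$, $1\cdot C=C$, $2\cdot\partial D=H\cdot\partial C=\partial D$, $1\cdot\partial C=\partial C$, else $0$. - $J(x,y,z)=x$ if $x=y$; $x\wedge z$ if $x=\partial y\in V\cup W$; $0$ otherwise. $J'(x,y,z)=x\wedge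 z$ if $x=y$; $x$ if $x=\partial y\in V\cup W$; $0$ otherwise. $K(x,y,z)=y$ if $x=\partial y\in V\cup W$; $z$ if $x=y=\partial z\in V\cup W$; $x\wedge y\wedge z$ otherwise. - $S_0(u,x,y,z)=(x\wedge y)\vee(x\wedge z)$ if $u\in V_0$, else $0$; $S_1(u,x,y,z)=(x\wedge y)\vee(x\wedge z)$ if $u\in\{1,2\}$, else $0$; $S_2(u,v,x,y,z)=(x\wedge y)\vee(x\wedge z)$ if $u=\partial v\in V\cup W$, else $0$. - $T(w,x,y,z)=w\cdot x$ if $w\cdot x=y\cdot z$ and $(w,x)=(y,z)$; $\partial(w\cdot x)$ if $w\cdot x=y\cdot z\ne0$ and $(w,x)\ne(y,z)$; $0$ otherwise. - $I(x)=C_{10}^0$ if $x=1$, $M_1^0$ if $x=H$, $D_{10}^0$ if $x=2$, else $0$. - for each instruction $(\mu_i,r,s,\mathrm{L},\mu_j)$ of $\mathcal{T}$ and $t\in\{0,1\}$: $L_{irt}(x,y,u)=C_{jt}^{s'}$ if $x=y=1$, $u=C_{ir}^{s'}$; $M_j^t$ if $x=H,y=1,u=C_{ir}^t$; $D_{jt}^s$ if $x=2,y=H,u=M_i^r$; $D_{jt}^{s'}$ if $x=y=2,u=D_{ir}^{s'}$; $\partial v$ if $u\in V$ and $L_{irt}(x,y,\partial u)=v\in V$ by the preceding clauses; $0$ otherwise. - for each instruction $(\mu_i,r,s,\mathrm{R},\mu_j)$ and $t\in\{0,1\}$: $R_{irt}(x,y,u)=C_{jt}^{s'}$ if $x=y=1,u=C_{ir}^{s'}$;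 $C_{jt}^s$ if $x=H,y=1,u=M_i^r$; $M_j^t$ if $x=2,y=H,u=D_{ir}^t$; $D_{jt}^{s'}$ if $x=y=2,u=D_{ir}^{s'}$; $\partial v$ if $u\in V$ and $R_{irt}(x,y,\partial u)=v\in V$ by the preceding clauses; $0$ otherwise. - with $\mathcal{L},\mathcal{R}$ the sets of these operations and $x\prec y$ iff $(x,y)\in\{(2,2),(2,H),(1,1)\}$, for each $F\in\mathcal{L}\cup\mathcal{R}$: $U_F^1(x,y,z,u)=\partial F(x,y,u)$ if $x\prec z,y\ne z,F(x,y,u)\ne0$; $F(x,y,u)$ if $x\prec z,y=z,F(x,y,u)\ne0$; $0$ otherwise; and $U_F^0(x,y,z,u)=\partial F(y,z,u)$ if $x\prec z,x\ne y,F(y,z,u)\ne0$; $F(y,z,u)$ if $x\prec z,x=y,F(y,z,u)\ne0$; $0$ otherwise. -}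

module Defs where

open import Level using (Level; _⊔_) renaming (suc to lsuc)
open import Data.Nat using (ℕ; zero; suc)
open import Data.Fin using (Fin) renaming (zero to f0; suc to fs)
import Data.Fin as Fin
open import Data.Bool using (Bool; true; false; if_then_else_; not) renaming (_∧_ to _&&_; _∨_ to _||_)
import Data.Bool.Properties as BoolP
open import Data.List using (List; length; lookup)
open import Data.Product using (Σ; ∃; _,_; proj₁; proj₂)
open import Relation.Binary using (Rel; IsEquivalence)
open import Relation.Binary.PropositionalEquality using (_≡_)
open import Relation.Nullary.Decidable using (⌊_⌋)

-- Turing machines (states μ₀,…,μₙ with n = m+1 ≥ 1, since the
-- operation I mentions the state μ₁; tape symbols r,s ∈ {0,1} coded
-- as Bool with false = 0, true = 1).

data Dir : Set where
  Lft Rgt : Dir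

record Instr (N : ℕ) : Set where
  constructor instr
  field
    src  : Fin N
    rd   : Bool
    wr   : Bool
    dir  : Dir
    tgt  : Fin N

record TM : Set where
  field
    m      : ℕ
    instrs : List (Instr (suc (suc m)))
  N : ℕ
  N = suc (suc m)

module Construction (T : TM) where
  open TM T

  -- The last Bool of the W/V constructors records whether
  -- the element is ∂-decorated.
  --   wC b   : C (b = false) / ∂C (b = true)
  --   vC i r s b : C_{ir}^s / ∂C_{ir}^s,   vD similar,
  --   vM i r b   : M_i^r / ∂M_i^r
  data El : Set where
    𝟎 𝟏 𝟐 𝐇 : El
    wC wD    : Bool → El
    vC vD    : Fin N → Bool → Bool → Bool → El
    vM       : Fin N → Bool → Bool → El

  private
    eqB : Bool → Bool → Bool
    eqB a b = ⌊ a BoolP.≟ b ⌋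
    eqF : Fin N → Fin N → Bool
    eqF i j = ⌊ i Fin.≟ j ⌋

  _==_ : El → El → Bool
  𝟎 == 𝟎 = true
  𝟏 == 𝟏 = true
  𝟐 == 𝟐 = true
  𝐇 == 𝐇 = true
  wC a == wC b = eqB a b
  wD a == wD b = eqB a b
  vC i r s a == vC i' r' s' a' = eqF i i' && eqB r r' && eqB s s' && eqB a a'
  vD i r s a == vD i' r' s' a' = eqF i i' && eqB r r' && eqB s s' && eqB a a'
  vM i r a == vM i' r' a' = eqF i i' && eqB r r' && eqB a a'
  _ == _ = false

  isV : El → Bool
  isV (vC _ _ _ _) = true
  isV (vD _ _ _ _) = true
  isV (vM _ _ _)   = true
  isV _ = false

  isVW : El → Bool
  isVW (wC _) = true
  isVW (wD _) = true
  isVW x = isV x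

  isV0 : El → Bool
  isV0 (vC i _ _ _) = eqF i f0
  isV0 (vD i _ _ _) = eqF i f0
  isV0 (vM i _ _)   = eqF i f0
  isV0 _ = false

  is12 : El → Bool
  is12 𝟏 = true
  is12 𝟐 = true
  is12 _ = false

  -- the involution ∂ on V ∪ W (identity elsewhere; only used on V ∪ W)
  ∂ : El → El
  ∂ (wC b) = wC (not b)
  ∂ (wD b) = wD (not b)
  ∂ (vC i r s b) = vC i r s (not b)
  ∂ (vD i r s b) = vD i r s (not b)
  ∂ (vM i r b) = vM i r (not b)
  ∂ x = x

  isDual : El → El → Bool
  isDual x y = isVW y && (x == ∂ y)

  _⊓_ : El → El → El
  x ⊓ y = if x == y then x else 𝟎

  -- join of p,q ∈ {x,0}
  _⊔₀_ : El → El → El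
  p ⊔₀ q = if p == 𝟎 then q else p

  _·_ : El → El → El
  𝟐 · wD b = wD b
  𝐇 · wC b = wD b
  𝟏 · wC b = wC b
  _ · _ = 𝟎

  Jop J'op Kop : El → El → El → El
  Jop x y z = if x == y then x else (if isDual x y then x ⊓ z else 𝟎)
  J'op x y z = if x == y then x ⊓ z else (if isDual x y then x else 𝟎)
  Kop x y z = if isDual x y then y
              else (if (x == y) && isDual y z then z else ((x ⊓ y) ⊓ z))

  S0op S1op : El → El → El → El → El
  S0op u x y z = if isV0 u then (x ⊓ y) ⊔₀ (x ⊓ z) else 𝟎
  S1op u x y z = if is12 u then (x ⊓ y) ⊔₀ (x ⊓ z) else 𝟎

  S2op : El → El → El → El → El → El
  S2op u v x y z = if isDual u v then (x ⊓ y) ⊔₀ (x ⊓ z) else 𝟎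

  Top : El → El → El → El → El
  Top w x y z =
    if ((w · x) == (y · z)) && ((w == y) && (x == z)) then w · x
    else (if ((w · x) == (y · z)) && not ((w · x) == 𝟎) then ∂ (w · x) else 𝟎)

  Iop : El → El
  Iop 𝟏 = vC (fs f0) false false false
  Iop 𝐇 = vM (fs f0) false false
  Iop 𝟐 = vD (fs f0) false false false
  Iop _ = 𝟎

  -- the "preceding clauses" of L_{irt} / R_{irt}
  baseL : Instr N → Bool → El → El → El → El
  baseL (instr i r s _ j) t 𝟏 𝟏 (vC i' r' s' false) =
    if eqF i i' && eqB r r' then vC j t s' false else 𝟎
  baseL (instr i r s _ j) t 𝐇 𝟏 (vC i' r' s' false) =
    if eqF i i' && eqB r r' && eqB s' t then vM j t false else 𝟎
  baseL (instr i r s _ j) t 𝟐 𝐇 (vM i' r' false) =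
    if eqF i i' && eqB r r' then vD j t s false else 𝟎
  baseL (instr i r s _ j) t 𝟐 𝟐 (vD i' r' s' false) =
    if eqF i i' && eqB r r' then vD j t s' false else 𝟎
  baseL _ _ _ _ _ = 𝟎

  baseR : Instr N → Bool → El → El → El → El
  baseR (instr i r s _ j) t 𝟏 𝟏 (vC i' r' s' false) =
    if eqF i i' && eqB r r' then vC j t s' false else 𝟎
  baseR (instr i r s _ j) t 𝐇 𝟏 (vM i' r' false) =
    if eqF i i' && eqB r r' then vC j t s false else 𝟎
  baseR (instr i r s _ j) t 𝟐 𝐇 (vD i' r' s' false) =
    if eqF i i' && eqB r r' && eqB s' t then vM j t false else 𝟎
  baseR (instr i r s _ j) t 𝟐 𝟐 (vD i' r' s' false) =
    if eqF i i' && eqB r r' then vD j t s' false else 𝟎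
  baseR _ _ _ _ _ = 𝟎

  base : Instr N → Bool → El → El → El → El
  base ins with Instr.dir ins
  ... | Lft = baseL ins
  ... | Rgt = baseR ins

  Fop : Instr N → Bool → El → El → El → El
  Fop ins t x y u =
    if isV (base ins t x y u) then base ins t x y u
    else (if isV u && isV (base ins t x y (∂ u)) then ∂ (base ins t x y (∂ u)) else 𝟎)

  prec : El → El → Bool
  prec 𝟐 𝟐 = true
  prec 𝟐 𝐇 = true
  prec 𝟏 𝟏 = true
  prec _ _ = false

  U1op U0op : Instr N → Bool → El → El → El → El → El
  U1op ins t x y z u =
    if prec x z && not (Fop ins t x y u == 𝟎)
    then (if y == z then Fop ins t x y u else ∂ (Fop ins t x y u))
    else 𝟎
  U0op ins t x y z u =
    if prec x z && not (Fop ins t y z u == 𝟎)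
    then (if x == y then Fop ins t y z u else ∂ (Fop ins t y z u))
    else 𝟎

  Idx : Set
  Idx = Fin (length instrs)

  data Op : Set where
    `0 : Op
    `∧ `· : Op
    `J `J' `K : Op
    `S0 `S1 : Op
    `S2 : Op
    `T : Op
    `I : Op
    `F : Idx → Bool → Op
    `U1 `U0 : Idx → Bool → Op

  arity : Op → ℕ
  arity `0 = 0
  arity `∧ = 2
  arity `· = 2
  arity `J = 3
  arity `J' = 3
  arity `K = 3
  arity `S0 = 4
  arity `S1 = 4
  arity `S2 = 5
  arity `T = 4
  arity `I = 1
  arity (`F _ _) = 3
  arity (`U1 _ _) = 4
  arity (`U0 _ _) = 4

  private
    a0 : ∀ {k} → (Fin (suc k) → El) → El
    a0 as = as f0
    a1 : ∀ {k} → (Fin (suc (suc k)) → El) → El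
    a1 as = as (fs f0)
    a2 : ∀ {k} → (Fin (suc (suc (suc k))) → El) → El
    a2 as = as (fs (fs f0))
    a3 : ∀ {k} → (Fin (suc (suc (suc (suc k)))) → El) → El
    a3 as = as (fs (fs (fs f0)))
    a4 : ∀ {k} → (Fin (suc (suc (suc (suc (suc k))))) → El) → El
    a4 as = as (fs (fs (fs (fs f0))))

  opA : (o : Op) → (Fin (arity o) → El) → El
  opA `0 as = 𝟎
  opA `∧ as = a0 as ⊓ a1 as
  opA `· as = a0 as · a1 as
  opA `J as = Jop (a0 as) (a1 as) (a2 as)
  opA `J' as = J'op (a0 as) (a1 as) (a2 as)
  opA `K as = Kop (a0 as) (a1 as) (a2 as)
  opA `S0 as = S0op (a0 as) (a1 as) (a2 as) (a3 as)
  opA `S1 as = S1op (a0 as) (a1 as) (a2 as) (a3 as)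
  opA `S2 as = S2op (a0 as) (a1 as) (a2 as) (a3 as) (a4 as)
  opA `T as = Top (a0 as) (a1 as) (a2 as) (a3 as)
  opA `I as = Iop (a0 as)
  opA (`F k t) as = Fop (lookup instrs k) t (a0 as) (a1 as) (a2 as)
  opA (`U1 k t) as = U1op (lookup instrs k) t (a0 as) (a1 as) (a2 as) (a3 as)
  opA (`U0 k t) as = U0op (lookup instrs k) t (a0 as) (a1 as) (a2 as) (a3 as)

  record Algebra (α ρ : Level) : Set (lsuc (α ⊔ ρ)) where
    field
      Carrier : Set α
      _≈_     : Rel Carrier ρ
      isEquiv : IsEquivalence _≈_
      ⟦_⟧     : (o : Op) → (Fin (arity o) → Carrier) → Carrier
      ⟦⟧-cong : ∀ o {as bs : Fin (arity o) → Carrier} →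
                (∀ j → as j ≈ bs j) → ⟦ o ⟧ as ≈ ⟦ o ⟧ bs

  -- Membership in V(A'(T)) = HSP(A'(T)):
  -- B is a homomorphic image of a subalgebra of a power A'(T)^I.

  record InV {α ρ : Level} (B : Algebra α ρ) (ι π : Level)
         : Set (lsuc ι ⊔ lsuc π ⊔ α ⊔ ρ) where
    open Algebra B
    field
      I       : Set ι
      P       : (I → El) → Set π
      closed  : ∀ o (as : Fin (arity o) → I → El) → (∀ j → P (as j)) →
                P (λ i → opA o (λ j → as j i))
    Sub : Set (ι ⊔ π)
    Sub = Σ (I → El) P
    opS : (o : Op) → (Fin (arity o) → Sub) → Sub
    opS o as = (λ i → opA o (λ j → proj₁ (as j) i)) ,
               closed o (λ j → proj₁ (as j)) (λ j → proj₂ (as j))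
    field
      h       : Sub → Carrier
      h-cong  : ∀ {a b : Sub} → (∀ i → proj₁ a i ≡ proj₁ b i) → h a ≈ h b
      h-hom   : ∀ o (as : Fin (arity o) → Sub) →
                h (opS o as) ≈ ⟦ o ⟧ (λ j → h (as j))
      h-surj  : ∀ (b : Carrier) → ∃ λ (s : Sub) → h s ≈ b

module Submission where

-- S2(u,v,w,w,w) equals w when u and v are dual and 0 otherwise, and J, J', K
-- look at their "extra" arguments only in the dual situation.  Hence in A'(T) each of
-- J, J', K can be written as a term s in which S2-terms occupy certain holes, while
-- the same s with 0 in those holes equals x ∧ y, resp. x ∧ y ∧ z.  Identities of A'(T)
-- hold throughout V(A'(T)), and in B the S2-terms may be replaced by 0.

open import Level using (Level; 0ℓ; _⊔_)
open import Function using (_∘_)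
open import Data.Bool using (Bool; true; false; if_then_else_) renaming (_∧_ to _&&_)
import Data.Bool.Properties as BoolP
open import Data.Empty using (⊥-elim)
open import Data.Fin using (Fin) renaming (zero to f0; suc to fs)
import Data.Fin as Fin
open import Data.Product using (_×_; _,_; proj₁; proj₂)
open import Data.Sum using (_⊎_; inj₁; inj₂; [_,_])
open import Data.Unit using (tt)
import Data.Vec as Vec
import Data.Vec.Properties as VecP
open import Data.Vec.Functional using ([]; _∷_)
open import Relation.Binary using (IsEquivalence; Setoid)
import Relation.Binary.Reasoning.Setoid as SetoidReasoning
open import Relation.Binary.PropositionalEquality
  using (_≡_; _≢_; refl; sym; trans; cong; cong₂; module ≡-Reasoning)
open import Relation.Binary.PropositionalEquality.Properties using (isEquivalence)
open import Relation.Nullary using (Dec; yes; no)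
open import Relation.Nullary.Decidable using (⌊_⌋; dec-true; isYes≗does)

open import Defs

&&-true : ∀ {a b} → a && b ≡ true → a ≡ true × b ≡ true
&&-true {true} h = refl , h

⌊⌋-complete : ∀ {P : Set} (d : Dec P) → P → ⌊ d ⌋ ≡ true
⌊⌋-complete d p = trans (isYes≗does d) (dec-true d p)

⌊⌋-sound : ∀ {P : Set} (d : Dec P) → ⌊ d ⌋ ≡ true → P
⌊⌋-sound (yes p) _ = p
⌊⌋-sound (no _) ()

⌊⌋-sound-∧ : ∀ {P : Set} (d : Dec P) {b : Bool} → ⌊ d ⌋ && b ≡ true → P × b ≡ true
⌊⌋-sound-∧ (yes p) h = p , h
⌊⌋-sound-∧ (no _) ()

module ElementFacts (T : TM) where
  open Construction T

  ==-refl : ∀ x → (x == x) ≡ true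
  ==-refl 𝟎 = refl
  ==-refl 𝟏 = refl
  ==-refl 𝟐 = refl
  ==-refl 𝐇 = refl
  ==-refl (wC a) rewrite ⌊⌋-complete (a BoolP.≟ a) refl = refl
  ==-refl (wD a) rewrite ⌊⌋-complete (a BoolP.≟ a) refl = refl
  ==-refl (vC i r s a)
    rewrite ⌊⌋-complete (i Fin.≟ i) refl | ⌊⌋-complete (r BoolP.≟ r) refl
          | ⌊⌋-complete (s BoolP.≟ s) refl | ⌊⌋-complete (a BoolP.≟ a) refl = refl
  ==-refl (vD i r s a)
    rewrite ⌊⌋-complete (i Fin.≟ i) refl | ⌊⌋-complete (r BoolP.≟ r) refl
          | ⌊⌋-complete (s BoolP.≟ s) refl | ⌊⌋-complete (a BoolP.≟ a) refl = refl
  ==-refl (vM i r a)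
    rewrite ⌊⌋-complete (i Fin.≟ i) refl | ⌊⌋-complete (r BoolP.≟ r) refl
          | ⌊⌋-complete (a BoolP.≟ a) refl = refl

  ==-sound : ∀ x y → (x == y) ≡ true → x ≡ y
  ==-sound 𝟎 𝟎 _ = refl
  ==-sound 𝟏 𝟏 _ = refl
  ==-sound 𝟐 𝟐 _ = refl
  ==-sound 𝐇 𝐇 _ = refl
  ==-sound (wC a) (wC b) h with refl ← ⌊⌋-sound (a BoolP.≟ b) h = refl
  ==-sound (wD a) (wD b) h with refl ← ⌊⌋-sound (a BoolP.≟ b) h = refl
  ==-sound (vC i r s a) (vC j r′ s′ b) h
    with refl , h ← ⌊⌋-sound-∧ (i Fin.≟ j) h
    with refl , h ← ⌊⌋-sound-∧ (r BoolP.≟ r′) h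
    with refl , h ← ⌊⌋-sound-∧ (s BoolP.≟ s′) h
    with refl ← ⌊⌋-sound (a BoolP.≟ b) h = refl
  ==-sound (vD i r s a) (vD j r′ s′ b) h
    with refl , h ← ⌊⌋-sound-∧ (i Fin.≟ j) h
    with refl , h ← ⌊⌋-sound-∧ (r BoolP.≟ r′) h
    with refl , h ← ⌊⌋-sound-∧ (s BoolP.≟ s′) h
    with refl ← ⌊⌋-sound (a BoolP.≟ b) h = refl
  ==-sound (vM i r a) (vM j r′ b) h
    with refl , h ← ⌊⌋-sound-∧ (i Fin.≟ j) h
    with refl , h ← ⌊⌋-sound-∧ (r BoolP.≟ r′) h
    with refl ← ⌊⌋-sound (a BoolP.≟ b) h = refl
  ==-sound 𝟎 𝟏 () ; ==-sound 𝟎 𝟐 () ; ==-sound 𝟎 𝐇 () ; ==-sound 𝟎 (wC _) () ; ==-sound 𝟎 (wD _) ()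
  ==-sound 𝟎 (vC _ _ _ _) () ; ==-sound 𝟎 (vD _ _ _ _) () ; ==-sound 𝟎 (vM _ _ _) ()
  ==-sound 𝟏 𝟎 () ; ==-sound 𝟏 𝟐 () ; ==-sound 𝟏 𝐇 () ; ==-sound 𝟏 (wC _) () ; ==-sound 𝟏 (wD _) ()
  ==-sound 𝟏 (vC _ _ _ _) () ; ==-sound 𝟏 (vD _ _ _ _) () ; ==-sound 𝟏 (vM _ _ _) ()
  ==-sound 𝟐 𝟎 () ; ==-sound 𝟐 𝟏 () ; ==-sound 𝟐 𝐇 () ; ==-sound 𝟐 (wC _) () ; ==-sound 𝟐 (wD _) ()
  ==-sound 𝟐 (vC _ _ _ _) () ; ==-sound 𝟐 (vD _ _ _ _) () ; ==-sound 𝟐 (vM _ _ _) ()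
  ==-sound 𝐇 𝟎 () ; ==-sound 𝐇 𝟏 () ; ==-sound 𝐇 𝟐 () ; ==-sound 𝐇 (wC _) () ; ==-sound 𝐇 (wD _) ()
  ==-sound 𝐇 (vC _ _ _ _) () ; ==-sound 𝐇 (vD _ _ _ _) () ; ==-sound 𝐇 (vM _ _ _) ()
  ==-sound (wC _) 𝟎 () ; ==-sound (wC _) 𝟏 () ; ==-sound (wC _) 𝟐 () ; ==-sound (wC _) 𝐇 ()
  ==-sound (wC _) (wD _) () ; ==-sound (wC _) (vC _ _ _ _) () ; ==-sound (wC _) (vD _ _ _ _) ()
  ==-sound (wC _) (vM _ _ _) ()
  ==-sound (wD _) 𝟎 () ; ==-sound (wD _) 𝟏 () ; ==-sound (wD _) 𝟐 () ; ==-sound (wD _) 𝐇 ()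
  ==-sound (wD _) (wC _) () ; ==-sound (wD _) (vC _ _ _ _) () ; ==-sound (wD _) (vD _ _ _ _) ()
  ==-sound (wD _) (vM _ _ _) ()
  ==-sound (vC _ _ _ _) 𝟎 () ; ==-sound (vC _ _ _ _) 𝟏 () ; ==-sound (vC _ _ _ _) 𝟐 ()
  ==-sound (vC _ _ _ _) 𝐇 () ; ==-sound (vC _ _ _ _) (wC _) () ; ==-sound (vC _ _ _ _) (wD _) ()
  ==-sound (vC _ _ _ _) (vD _ _ _ _) () ; ==-sound (vC _ _ _ _) (vM _ _ _) ()
  ==-sound (vD _ _ _ _) 𝟎 () ; ==-sound (vD _ _ _ _) 𝟏 () ; ==-sound (vD _ _ _ _) 𝟐 ()
  ==-sound (vD _ _ _ _) 𝐇 () ; ==-sound (vD _ _ _ _) (wC _) () ; ==-sound (vD _ _ _ _) (wD _) ()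
  ==-sound (vD _ _ _ _) (vC _ _ _ _) () ; ==-sound (vD _ _ _ _) (vM _ _ _) ()
  ==-sound (vM _ _ _) 𝟎 () ; ==-sound (vM _ _ _) 𝟏 () ; ==-sound (vM _ _ _) 𝟐 ()
  ==-sound (vM _ _ _) 𝐇 () ; ==-sound (vM _ _ _) (wC _) () ; ==-sound (vM _ _ _) (wD _) ()
  ==-sound (vM _ _ _) (vC _ _ _ _) () ; ==-sound (vM _ _ _) (vD _ _ _ _) ()

  ==-sym : ∀ x y → (x == y) ≡ (y == x)
  ==-sym x y with x == y in e | y == x in e′
  ... | true  | true  = refl
  ... | false | false = refl
  ... | true  | false with refl ← ==-sound x y e = trans (sym (==-refl x)) e′
  ... | false | true  with refl ← ==-sound y x e′ = trans (sym e) (==-refl x)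

  ∂-involutive : ∀ x → ∂ (∂ x) ≡ x
  ∂-involutive 𝟎 = refl
  ∂-involutive 𝟏 = refl
  ∂-involutive 𝟐 = refl
  ∂-involutive 𝐇 = refl
  ∂-involutive (wC a) = cong wC (BoolP.not-involutive a)
  ∂-involutive (wD a) = cong wD (BoolP.not-involutive a)
  ∂-involutive (vC i r s a) = cong (vC i r s) (BoolP.not-involutive a)
  ∂-involutive (vD i r s a) = cong (vD i r s) (BoolP.not-involutive a)
  ∂-involutive (vM i r a) = cong (vM i r) (BoolP.not-involutive a)

  isVW-∂ : ∀ x → isVW (∂ x) ≡ isVW x
  isVW-∂ (wC _) = refl
  isVW-∂ (wD _) = refl
  isVW-∂ (vC _ _ _ _) = refl
  isVW-∂ (vD _ _ _ _) = refl
  isVW-∂ (vM _ _ _) = refl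
  isVW-∂ 𝟎 = refl
  isVW-∂ 𝟏 = refl
  isVW-∂ 𝟐 = refl
  isVW-∂ 𝐇 = refl

  decoration : El → Bool
  decoration (wC a) = a
  decoration (wD a) = a
  decoration (vC _ _ _ a) = a
  decoration (vD _ _ _ a) = a
  decoration (vM _ _ a) = a
  decoration _ = false

  ∂-no-fixpoint : ∀ x → isVW x ≡ true → x ≢ ∂ x
  ∂-no-fixpoint (wC _) _ p = BoolP.not-¬ refl (cong decoration p)
  ∂-no-fixpoint (wD _) _ p = BoolP.not-¬ refl (cong decoration p)
  ∂-no-fixpoint (vC _ _ _ _) _ p = BoolP.not-¬ refl (cong decoration p)
  ∂-no-fixpoint (vD _ _ _ _) _ p = BoolP.not-¬ refl (cong decoration p)
  ∂-no-fixpoint (vM _ _ _) _ p = BoolP.not-¬ refl (cong decoration p)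

  dual-sound : ∀ x y → isDual x y ≡ true → isVW y ≡ true × x ≡ ∂ y
  dual-sound x y d = let vw , eq = &&-true d in vw , ==-sound x (∂ y) eq

  dual-flip : ∀ x y → isDual x y ≡ true → isDual y x ≡ true
  dual-flip x y d with vw , refl ← dual-sound x y d
    rewrite isVW-∂ y | ∂-involutive y | vw = ==-refl y

  dual-irrefl : ∀ x → isDual x x ≡ false
  dual-irrefl x with isDual x x in d
  ... | false = refl
  ... | true  = let vw , eq = dual-sound x x d in ⊥-elim (∂-no-fixpoint x vw eq)

  dual-zero : ∀ w → isDual 𝟎 w ≡ false
  dual-zero w with isDual 𝟎 w in d
  ... | false = refl
  ... | true  = let vw , eq = dual-sound 𝟎 w d
                in sym (trans (trans (cong isVW eq) (isVW-∂ w)) vw)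

  data Position (x y : El) : Set where
    equal : x ≡ y → Position x y
    dual  : (x == y) ≡ false → isDual x y ≡ true → Position x y
    apart : (x == y) ≡ false → isDual x y ≡ false → Position x y

  position : ∀ x y → Position x y
  position x y with x == y in e | isDual x y in d
  ... | true  | _     = equal (==-sound x y e)
  ... | false | true  = dual e d
  ... | false | false = apart e d

  ⊓-idem : ∀ x → x ⊓ x ≡ x
  ⊓-idem x rewrite ==-refl x = refl

  ⊓-zeroʳ : ∀ x → x ⊓ 𝟎 ≡ 𝟎
  ⊓-zeroʳ x with x == 𝟎 in e
  ... | true  = ==-sound x 𝟎 e
  ... | false = refl

  ⊓-zeroˡ : ∀ x → 𝟎 ⊓ x ≡ 𝟎
  ⊓-zeroˡ x with 𝟎 == x
  ... | true  = refl
  ... | false = refl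

  ⊓-absorb : ∀ x z → (x ⊓ z) ⊓ x ≡ x ⊓ z
  ⊓-absorb x z with x == z
  ... | true  = ⊓-idem x
  ... | false = ⊓-zeroˡ x

  ⊔₀-idem : ∀ x → x ⊔₀ x ≡ x
  ⊔₀-idem x with x == 𝟎
  ... | true  = refl
  ... | false = refl

module Identities (T : TM) where
  open Construction T
  open ElementFacts T

  S2-diagonal : ∀ u v w → S2op u v w w w ≡ (if isDual u v then w else 𝟎)
  S2-diagonal u v w with isDual u v
  ... | true  = trans (cong₂ _⊔₀_ (⊓-idem w) (⊓-idem w)) (⊔₀-idem w)
  ... | false = refl

  -- J(x,y,z) reads z only when x and y are dual; with 0 in that place, J is the meet
  J-guard : ∀ x y z → Jop x y z ≡ Jop x y (S2op x y z z z)
  J-guard x y z rewrite S2-diagonal x y z with x == y | isDual x y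
  ... | true  | _     = refl
  ... | false | true  = refl
  ... | false | false = refl

  J-zero : ∀ x y → Jop x y 𝟎 ≡ x ⊓ y
  J-zero x y with x == y | isDual x y
  ... | true  | _     = refl
  ... | false | true  = ⊓-zeroʳ x
  ... | false | false = refl

  J'-guard : ∀ x y z → J'op x y z ≡ J'op x y z ⊓ Jop x y (S2op x y x x x)
  J'-guard x y z rewrite S2-diagonal x y x with x == y | isDual x y
  ... | true  | _     = sym (⊓-absorb x z)
  ... | false | true  = sym (trans (cong (x ⊓_) (⊓-idem x)) (⊓-idem x))
  ... | false | false = refl

  J'-zero : ∀ x y z → J'op x y z ⊓ Jop x y 𝟎 ≡ (x ⊓ y) ⊓ z
  J'-zero x y z with x == y | isDual x y
  ... | true  | _     = ⊓-absorb x z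
  ... | false | true  = trans (cong (x ⊓_) (⊓-zeroʳ x)) (trans (⊓-zeroʳ x) (sym (⊓-zeroˡ z)))
  ... | false | false = sym (⊓-zeroˡ z)

  link-equal : ∀ x → Jop x x (S2op x x x x x) ≡ x
  link-equal x rewrite ==-refl x = refl

  link-dual : ∀ x y → isDual x y ≡ true → Jop y x (S2op x y y y y) ≡ y
  link-dual x y d rewrite S2-diagonal x y y | d | dual-flip x y d with y == x
  ... | true  = refl
  ... | false = ⊓-idem y

  link-apart : ∀ x y → (x == y) ≡ false → isDual x y ≡ false → Jop y x (S2op x y y y y) ≡ 𝟎
  link-apart x y e d rewrite S2-diagonal x y y | d | J-zero y x | ==-sym y x | e = refl

  K-zero-middle : ∀ x w → Kop x 𝟎 w ≡ 𝟎
  K-zero-middle x w rewrite dual-zero w | BoolP.∧-zeroʳ (x == 𝟎) | ⊓-zeroʳ x = ⊓-zeroˡ w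

  K-self : ∀ x → Kop x x x ≡ x
  K-self x rewrite dual-irrefl x | ==-refl x | ==-refl x = refl

  K-self-zero : ∀ x → Kop x x 𝟎 ≡ 𝟎
  K-self-zero x rewrite dual-irrefl x | ==-refl x = ⊓-zeroʳ x

  K-self-apart : ∀ x z → (x == z) ≡ false → isDual x z ≡ false → Kop x x z ≡ 𝟎
  K-self-apart x z e d rewrite dual-irrefl x | ==-refl x | d | e = refl

  K-guard : ∀ x y z → Kop x y z ≡ Kop x (Jop y x (S2op x y y y y)) (Jop z y (S2op y z z z z))
  K-guard x y z with position x y
  ... | dual _ d rewrite link-dual x y d | d = refl
  ... | apart e d rewrite link-apart x y e d | d | e = trans (⊓-zeroˡ z) (sym (K-zero-middle x _))
  ... | equal refl rewrite link-equal x with position x z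
  ...   | equal refl rewrite link-equal x = refl
  ...   | dual _ d   rewrite link-dual x z d = refl
  ...   | apart e d  rewrite link-apart x z e d = trans (K-self-apart x z e d) (sym (K-self-zero x))

  K-distinct : ∀ x y z w → (x == y) ≡ false → Kop x (y ⊓ x) w ≡ (x ⊓ y) ⊓ z
  K-distinct x y z w e rewrite ==-sym y x | e = trans (K-zero-middle x w) (sym (⊓-zeroˡ z))

  K-self-meet : ∀ x z → Kop x x (z ⊓ x) ≡ x ⊓ z
  K-self-meet x z with position x z
  ... | equal refl = trans (cong (Kop x x) (⊓-idem x)) (trans (K-self x) (sym (⊓-idem x)))
  ... | dual e _   rewrite ==-sym z x | e = K-self-zero x
  ... | apart e _  rewrite ==-sym z x | e = K-self-zero x

  K-zero : ∀ x y z → Kop x (Jop y x 𝟎) (Jop z y 𝟎) ≡ (x ⊓ y) ⊓ z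
  K-zero x y z rewrite J-zero y x | J-zero z y with position x y
  ... | dual e _   = K-distinct x y z (z ⊓ y) e
  ... | apart e _  = K-distinct x y z (z ⊓ y) e
  ... | equal refl = begin
    Kop x (x ⊓ x) (z ⊓ x) ≡⟨ cong (λ w → Kop x w (z ⊓ x)) (⊓-idem x) ⟩
    Kop x x (z ⊓ x)       ≡⟨ K-self-meet x z ⟩
    x ⊓ z                 ≡⟨ cong (_⊓ z) (⊓-idem x) ⟨
    (x ⊓ x) ⊓ z           ∎
    where open ≡-Reasoning

module Equational (T : TM) where
  open Construction T

  data Tm (X : Set) : Set where
    var : X → Tm X
    op  : (o : Op) → (Fin (arity o) → Tm X) → Tm X

  infixl 30 _⟪_⟫
  _⟪_⟫ : ∀ {X Y : Set} → Tm X → (X → Tm Y) → Tm Y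
  var x   ⟪ σ ⟫ = σ x
  op o ts ⟪ σ ⟫ = op o (λ j → ts j ⟪ σ ⟫)

  -- fill the holes (variables from H) of a context s with the terms g
  fill : ∀ {X H : Set} → Tm (X ⊎ H) → (H → Tm X) → Tm X
  fill s g = s ⟪ [ var , g ] ⟫

  eval : ∀ {c} {C : Set c} → ((o : Op) → (Fin (arity o) → C) → C) →
         ∀ {X : Set} → Tm X → (X → C) → C
  eval ⟦o⟧ (var x)   β = β x
  eval ⟦o⟧ (op o ts) β = ⟦o⟧ o (λ j → eval ⟦o⟧ (ts j) β)

  infix 4 _⊨_≈_
  _⊨_≈_ : ∀ {α ρ} {X : Set} → Algebra α ρ → Tm X → Tm X → Set (α ⊔ ρ)
  B ⊨ t ≈ u = ∀ β → Algebra._≈_ B (eval (Algebra.⟦_⟧ B) t β) (eval (Algebra.⟦_⟧ B) u β)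

  -- every operation of A'(T) inspects only finitely many fixed argument positions,
  -- so it factors through the (inductive) vector of its arguments
  opA-η : ∀ o as → opA o as ≡ opA o (Vec.lookup (Vec.tabulate as))
  opA-η `0 as = refl
  opA-η `∧ as = refl
  opA-η `· as = refl
  opA-η `J as = refl
  opA-η `J' as = refl
  opA-η `K as = refl
  opA-η `S0 as = refl
  opA-η `S1 as = refl
  opA-η `S2 as = refl
  opA-η `T as = refl
  opA-η `I as = refl
  opA-η (`F _ _) as = refl
  opA-η (`U1 _ _) as = refl
  opA-η (`U0 _ _) as = refl

  opA-cong : ∀ o {as bs : Fin (arity o) → El} → (∀ j → as j ≡ bs j) → opA o as ≡ opA o bs
  opA-cong o {as} {bs} as≗bs = begin
    opA o as                               ≡⟨ opA-η o as ⟩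
    opA o (Vec.lookup (Vec.tabulate as))   ≡⟨ cong (opA o ∘ Vec.lookup) (VecP.tabulate-cong as≗bs) ⟩
    opA o (Vec.lookup (Vec.tabulate bs))   ≡⟨ opA-η o bs ⟨
    opA o bs                               ∎
    where open ≡-Reasoning

  A′ : Algebra 0ℓ 0ℓ
  A′ = record { Carrier = El ; _≈_ = _≡_ ; isEquiv = isEquivalence ; ⟦_⟧ = opA ; ⟦⟧-cong = opA-cong }

  module _ {α ρ} (B : Algebra α ρ) where
    open Algebra B
    open IsEquivalence isEquiv using () renaming (refl to ≈-refl)
    setoid : Setoid α ρ
    setoid = record { isEquivalence = isEquiv }
    open SetoidReasoning setoid

    eval-cong : ∀ {X : Set} (t : Tm X) {β β′ : X → Carrier} → (∀ x → β x ≈ β′ x) →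
                eval ⟦_⟧ t β ≈ eval ⟦_⟧ t β′
    eval-cong (var x)   β≈β′ = β≈β′ x
    eval-cong (op o ts) β≈β′ = ⟦⟧-cong o (λ j → eval-cong (ts j) β≈β′)

    ⊨-subst : ∀ {X Y : Set} (s : Tm X) {σ τ : X → Tm Y} → (∀ x → B ⊨ σ x ≈ τ x) →
              B ⊨ s ⟪ σ ⟫ ≈ s ⟪ τ ⟫
    ⊨-subst (var x)   σ≈τ β = σ≈τ x β
    ⊨-subst (op o ts) σ≈τ β = ⟦⟧-cong o (λ j → ⊨-subst (ts j) σ≈τ β)

    module _ {ι π} (inV : InV B ι π) where
      open InV inV

      eval-coordinatewise : ∀ {X : Set} (t : Tm X) (σ : X → Sub) i →
        proj₁ (eval opS t σ) i ≡ eval opA t (λ x → proj₁ (σ x) i)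
      eval-coordinatewise (var x)   σ i = refl
      eval-coordinatewise (op o ts) σ i = opA-cong o (λ j → eval-coordinatewise (ts j) σ i)

      h-eval : ∀ {X : Set} (t : Tm X) (σ : X → Sub) → h (eval opS t σ) ≈ eval ⟦_⟧ t (h ∘ σ)
      h-eval (var x)   σ = ≈-refl
      h-eval (op o ts) σ = begin
        h (opS o (λ j → eval opS (ts j) σ))      ≈⟨ h-hom o (λ j → eval opS (ts j) σ) ⟩
        ⟦ o ⟧ (λ j → h (eval opS (ts j) σ))      ≈⟨ ⟦⟧-cong o (λ j → h-eval (ts j) σ) ⟩
        ⟦ o ⟧ (λ j → eval ⟦_⟧ (ts j) (h ∘ σ))    ∎

      transfer : ∀ {X : Set} (t u : Tm X) → A′ ⊨ t ≈ u → B ⊨ t ≈ u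
      transfer t u t≈u β = begin
        eval ⟦_⟧ t β            ≈⟨ eval-cong t (λ x → proj₂ (h-surj (β x))) ⟨
        eval ⟦_⟧ t (h ∘ pre)    ≈⟨ h-eval t pre ⟨
        h (eval opS t pre)      ≈⟨ h-cong (λ i → trans (eval-coordinatewise t pre i)
                                          (trans (t≈u _) (sym (eval-coordinatewise u pre i)))) ⟩
        h (eval opS u pre)      ≈⟨ h-eval u pre ⟩
        eval ⟦_⟧ u (h ∘ pre)    ≈⟨ eval-cong u (λ x → proj₂ (h-surj (β x))) ⟩
        eval ⟦_⟧ u β            ∎
        where
          pre : _ → Sub
          pre x = proj₁ (h-surj (β x))

      transfer-modulo : ∀ {X H : Set} (t r : Tm X) (s : Tm (X ⊎ H)) (g c : H → Tm X) →
        (∀ k → B ⊨ g k ≈ c k) → A′ ⊨ t ≈ fill s g → A′ ⊨ fill s c ≈ r → B ⊨ t ≈ r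
      transfer-modulo t r s g c g≈c t≈sg sc≈r β = begin
        eval ⟦_⟧ t β           ≈⟨ transfer t (fill s g) t≈sg β ⟩
        eval ⟦_⟧ (fill s g) β  ≈⟨ ⊨-subst s hole≈ β ⟩
        eval ⟦_⟧ (fill s c) β  ≈⟨ transfer (fill s c) r sc≈r β ⟩
        eval ⟦_⟧ r β           ∎
        where
          hole≈ : ∀ y → B ⊨ [ var , g ] y ≈ [ var , c ] y
          hole≈ (inj₁ x) _ = ≈-refl
          hole≈ (inj₂ k)   = g≈c k

module UnderS2≈0 (T : TM) {α ρ ι π : Level} (B : Construction.Algebra T α ρ)
                 (inV : Construction.InV T B ι π)
                 (S2≈0 : ∀ u v x y z → Construction.Algebra._≈_ B
                           (Construction.Algebra.⟦_⟧ B Construction.`S2 (u ∷ v ∷ x ∷ y ∷ z ∷ []))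
                           (Construction.Algebra.⟦_⟧ B Construction.`0 [])) where
  open Construction T
  open Algebra B
  open IsEquivalence isEquiv using () renaming (refl to ≈-refl; trans to ≈-trans)
  open Identities T
  open Equational T
  open SetoidReasoning (setoid B)

  guard : ∀ {X : Set} → X → X → X → Tm X
  guard u v w = op `S2 (var u ∷ var v ∷ var w ∷ var w ∷ var w ∷ [])

  𝟘 : ∀ {X : Set} → Tm X
  𝟘 = op `0 []

  guard≈𝟘 : ∀ {X : Set} (u v w : X) → B ⊨ guard u v w ≈ 𝟘
  guard≈𝟘 u v w β = begin
    ⟦ `S2 ⟧ (λ j → eval ⟦_⟧ ((var u ∷ var v ∷ var w ∷ var w ∷ var w ∷ []) j) β)
      ≈⟨ ⟦⟧-cong `S2 (λ { f0 → ≈-refl ; (fs f0) → ≈-refl ; (fs (fs f0)) → ≈-refl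
                        ; (fs (fs (fs f0))) → ≈-refl ; (fs (fs (fs (fs f0)))) → ≈-refl }) ⟩
    ⟦ `S2 ⟧ (β u ∷ β v ∷ β w ∷ β w ∷ β w ∷ [])  ≈⟨ S2≈0 _ _ _ _ _ ⟩
    ⟦ `0 ⟧ []                                   ≈⟨ ⟦⟧-cong `0 (λ ()) ⟩
    eval ⟦_⟧ 𝟘 β                                ∎

  _∧ₜ_ : ∀ {X : Set} → Tm X → Tm X → Tm X
  t ∧ₜ u = op `∧ (t ∷ u ∷ [])

  vx vy vz : Fin 3
  vx = f0
  vy = fs f0
  vz = fs (fs f0)

  x̂ ŷ ẑ : Tm (Fin 3)
  x̂ = var vx
  ŷ = var vy
  ẑ = var vz

  ctx : ∀ {H : Set} → Fin 3 → Tm (Fin 3 ⊎ H)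
  ctx i = var (inj₁ i)

  hole : ∀ {H : Set} → H → Tm (Fin 3 ⊎ H)
  hole k = var (inj₂ k)

  J-identity : B ⊨ op `J var ≈ x̂ ∧ₜ ŷ
  J-identity = transfer-modulo B inV (op `J var) (x̂ ∧ₜ ŷ)
    (op `J (ctx vx ∷ ctx vy ∷ hole tt ∷ []))
    (λ _ → guard vx vy vz) (λ _ → 𝟘) (λ _ → guard≈𝟘 vx vy vz)
    (λ ρ → J-guard (ρ vx) (ρ vy) (ρ vz))
    (λ ρ → J-zero (ρ vx) (ρ vy))

  J'-identity : B ⊨ op `J' var ≈ (x̂ ∧ₜ ŷ) ∧ₜ ẑ
  J'-identity = transfer-modulo B inV (op `J' var) ((x̂ ∧ₜ ŷ) ∧ₜ ẑ)
    (op `J' (ctx vx ∷ ctx vy ∷ ctx vz ∷ []) ∧ₜ op `J (ctx vx ∷ ctx vy ∷ hole tt ∷ []))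
    (λ _ → guard vx vy vx) (λ _ → 𝟘) (λ _ → guard≈𝟘 vx vy vx)
    (λ ρ → J'-guard (ρ vx) (ρ vy) (ρ vz))
    (λ ρ → J'-zero (ρ vx) (ρ vy) (ρ vz))

  K-identity : B ⊨ op `K var ≈ (x̂ ∧ₜ ŷ) ∧ₜ ẑ
  K-identity = transfer-modulo B inV (op `K var) ((x̂ ∧ₜ ŷ) ∧ₜ ẑ)
    (op `K (ctx vx ∷ op `J (ctx vy ∷ ctx vx ∷ hole f0 ∷ [])
                   ∷ op `J (ctx vz ∷ ctx vy ∷ hole (fs f0) ∷ []) ∷ []))
    (guard vx vy vy ∷ guard vy vz vz ∷ []) (λ _ → 𝟘)
    (λ { f0 → guard≈𝟘 vx vy vy ; (fs f0) → guard≈𝟘 vy vz vz })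
    (λ ρ → K-guard (ρ vx) (ρ vy) (ρ vz))
    (λ ρ → K-zero (ρ vx) (ρ vy) (ρ vz))

  eval-x∧y : ∀ x y z → eval ⟦_⟧ (x̂ ∧ₜ ŷ) (x ∷ y ∷ z ∷ []) ≈ ⟦ `∧ ⟧ (x ∷ y ∷ [])
  eval-x∧y x y z = ⟦⟧-cong `∧ (λ { f0 → ≈-refl ; (fs f0) → ≈-refl })

  eval-x∧y∧z : ∀ x y z → eval ⟦_⟧ ((x̂ ∧ₜ ŷ) ∧ₜ ẑ) (x ∷ y ∷ z ∷ []) ≈ ⟦ `∧ ⟧ (⟦ `∧ ⟧ (x ∷ y ∷ []) ∷ z ∷ [])
  eval-x∧y∧z x y z = ⟦⟧-cong `∧ (λ { f0 → eval-x∧y x y z ; (fs f0) → ≈-refl })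

  J≈x∧y : ∀ x y z → ⟦ `J ⟧ (x ∷ y ∷ z ∷ []) ≈ ⟦ `∧ ⟧ (x ∷ y ∷ [])
  J≈x∧y x y z = ≈-trans (J-identity (x ∷ y ∷ z ∷ [])) (eval-x∧y x y z)

  J'≈x∧y∧z : ∀ x y z → ⟦ `J' ⟧ (x ∷ y ∷ z ∷ []) ≈ ⟦ `∧ ⟧ (⟦ `∧ ⟧ (x ∷ y ∷ []) ∷ z ∷ [])
  J'≈x∧y∧z x y z = ≈-trans (J'-identity (x ∷ y ∷ z ∷ [])) (eval-x∧y∧z x y z)

  K≈x∧y∧z : ∀ x y z → ⟦ `K ⟧ (x ∷ y ∷ z ∷ []) ≈ ⟦ `∧ ⟧ (⟦ `∧ ⟧ (x ∷ y ∷ []) ∷ z ∷ [])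
  K≈x∧y∧z x y z = ≈-trans (K-identity (x ∷ y ∷ z ∷ [])) (eval-x∧y∧z x y z)

lemma3p1 : ∀ {α ρ ι π : Level} (T : TM) (B : Construction.Algebra T α ρ) →
    Construction.InV T B ι π →
    (∀ u v x y z → Construction.Algebra._≈_ B (Construction.Algebra.⟦_⟧ B Construction.`S2 (u ∷ v ∷ x ∷ y ∷ z ∷ []))
                                             (Construction.Algebra.⟦_⟧ B Construction.`0 [])) →
    ∀ x y z →
      Construction.Algebra._≈_ B (Construction.Algebra.⟦_⟧ B Construction.`J (x ∷ y ∷ z ∷ []))
                                 (Construction.Algebra.⟦_⟧ B Construction.`∧ (x ∷ y ∷ []))
      × Construction.Algebra._≈_ B (Construction.Algebra.⟦_⟧ B Construction.`J' (x ∷ y ∷ z ∷ []))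
                                   (Construction.Algebra.⟦_⟧ B Construction.`∧ (Construction.Algebra.⟦_⟧ B Construction.`∧ (x ∷ y ∷ []) ∷ z ∷ []))
      × Construction.Algebra._≈_ B (Construction.Algebra.⟦_⟧ B Construction.`K (x ∷ y ∷ z ∷ []))
                                   (Construction.Algebra.⟦_⟧ B Construction.`∧ (Construction.Algebra.⟦_⟧ B Construction.`∧ (x ∷ y ∷ []) ∷ z ∷ []))
lemma3p1 T B inV S2≈0 x y z = J≈x∧y x y z , J'≈x∧y∧z x y z , K≈x∧y∧z x y z
  where open UnderS2≈0 T B inV S2≈0
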